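{- Let $G$ be a graph, $\gamma:E(G)\to\mathrm{GF}(2)^t$ and $\alpha\in\mathrm{GF}(2)^t$. Then the minimum cardinality of a cycle $C$ of $G$ (possibly empty) with $\gamma(C)=\alpha$ is $\tilde w(\alpha)$.
   Context: A cycle of $G$ is an edge set in which every vertex has even degree (a disjoint union of edge sets of circuits). For $F\subseteq E(G)$, $\gamma(F)=\sum_{e\in F}\gamma(e)$. A $(u,v)$-walk is a sequence $(v_0,e_1,v_1,\ldots,e_k,v_k)$ with $v_0=u$, $v_k=v$ and each $e_i$ an edge with ends $v_{i-1},v_i$; its length is $k$ and its parity is $\gamma(e_1)+\cdots+\gamma(e_k)$. A closed walk is a $(u,u)$-walk for some vertex $u$. For $\beta\in\mathrm{GF}(2)^t$, $w(\beta)$ is the minimum length of a closed walk of parity $\beta$ ($\infty$ if none), and $\tilde w(\beta)$ is the minimum of $\sum_{\delta\in S}w(\delta)$ over all subsets $S\subseteq\mathrm{GF}(2)^t$ with $\sum_{\delta\in S}\delta=\beta$. -}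

module Defs where

open import Data.Nat using (ℕ; zero; suc; _+_; _≤_; _%_)
open import Data.Bool using (Bool; true; false; _xor_; if_then_else_)
open import Data.Fin using (Fin)
open import Data.Fin.Subset using (Subset; _∈_; ∣_∣)
open import Data.Vec using (Vec; []; _∷_; replicate; zipWith; lookup)
open import Data.List using (List; []; _∷_; map; _++_; foldr; allFin)
open import Data.Product using (Σ; _×_; _,_; ∃)
open import Data.Sum using (_⊎_)
open import Data.Maybe using (Maybe; just; nothing)
open import Relation.Nullary using (¬_; does)
open import Relation.Binary.PropositionalEquality using (_≡_)
import Data.Fin as F

GF2^ : ℕ → Set
GF2^ t = Vec Bool t

0v : ∀ {t} → GF2^ t
0v = replicate _ false

_⊕_ : ∀ {t} → GF2^ t → GF2^ t → GF2^ t
_⊕_ = zipWith _xor_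

allVecs : (t : ℕ) → List (GF2^ t)
allVecs zero    = [] ∷ []
allVecs (suc t) = map (false ∷_) (allVecs t) ++ map (true ∷_) (allVecs t)

-- Finite graphs (loops and parallel edges allowed):
-- vertices Fin n, edges Fin m, each edge has an ordered pair of ends.

record Graph : Set where
  field
    n    : ℕ
    m    : ℕ
    ends : Fin m → Fin n × Fin n

open Graph public

[_] : Bool → ℕ
[ true ]  = 1
[ false ] = 0

-- degree of v in the edge set C (a loop at v contributes 2)
deg : (G : Graph) → Subset (m G) → Fin (n G) → ℕ
deg G C v = foldr _+_ 0 (map f (allFin (m G)))
  where
  f : Fin (m G) → ℕ
  f e with ends G e
  ... | (a , b) = if lookup C e
                  then [ does (a F.≟ v) ] + [ does (b F.≟ v) ]
                  else 0

IsCycle : (G : Graph) → Subset (m G) → Set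
IsCycle G C = ∀ v → deg G C v % 2 ≡ 0

γsum : (G : Graph) {t : ℕ} → (Fin (m G) → GF2^ t) → Subset (m G) → GF2^ t
γsum G γ C = foldr _⊕_ 0v (map (λ e → if lookup C e then γ e else 0v) (allFin (m G)))

Joins : (G : Graph) → Fin (m G) → Fin (n G) → Fin (n G) → Set
Joins G e x y = (ends G e ≡ (x , y)) ⊎ (ends G e ≡ (y , x))

data Walk (G : Graph) : Fin (n G) → Fin (n G) → Set where
  nil  : ∀ {u} → Walk G u u
  cons : ∀ {u w v} (e : Fin (m G)) → Joins G e u w → Walk G w v → Walk G u v

walkLength : ∀ {G u v} → Walk G u v → ℕ
walkLength nil           = 0
walkLength (cons _ _ W)  = suc (walkLength W)

walkParity : ∀ {G u v t} → (Fin (m G) → GF2^ t) → Walk G u v → GF2^ t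
walkParity γ nil          = 0v
walkParity γ (cons e _ W) = γ e ⊕ walkParity γ W

-- Minima in ℕ ∪ {∞}, with ∞ represented by nothing.
-- MinIs P m : m is the minimum of {k | P k} (nothing = the set is empty).

MinIs : (ℕ → Set) → Maybe ℕ → Set
MinIs P nothing  = ∀ k → ¬ P k
MinIs P (just k) = P k × (∀ j → P j → k ≤ j)

ClosedWalkOf : (G : Graph) {t : ℕ} → (Fin (m G) → GF2^ t) → GF2^ t → ℕ → Set
ClosedWalkOf G γ β k =
  Σ (Fin (n G)) λ u → Σ (Walk G u u) λ W → (walkLength W ≡ k) × (walkParity γ W ≡ β)

IsW : (G : Graph) {t : ℕ} → (Fin (m G) → GF2^ t) → GF2^ t → Maybe ℕ → Set
IsW G γ β x = MinIs (ClosedWalkOf G γ β) x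

sumSet : ∀ {t} → (GF2^ t → Bool) → GF2^ t
sumSet {t} S = foldr _⊕_ 0v (map (λ δ → if S δ then δ else 0v) (allVecs t))

-- Σ_{δ ∈ S} w(δ) = k  (finite): with f δ = w(δ) for every δ ∈ S.
-- If some w(δ), δ ∈ S, is ∞ then no finite k qualifies, as required.
SubsetWeight : (G : Graph) {t : ℕ} → (Fin (m G) → GF2^ t) → GF2^ t → ℕ → Set
SubsetWeight G {t} γ β k =
  Σ (GF2^ t → Bool) λ S →
    (sumSet S ≡ β) ×
    Σ (GF2^ t → ℕ) λ f →
      (∀ δ → S δ ≡ true → IsW G γ δ (just (f δ))) ×
      (foldr _+_ 0 (map (λ δ → if S δ then f δ else 0) (allVecs t)) ≡ k)

IsWTilde : (G : Graph) {t : ℕ} → (Fin (m G) → GF2^ t) → GF2^ t → Maybe ℕ → Set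
IsWTilde G γ β x = MinIs (SubsetWeight G γ β) x

CycleOf : (G : Graph) {t : ℕ} → (Fin (m G) → GF2^ t) → GF2^ t → ℕ → Set
CycleOf G γ α k =
  Σ (Subset (m G)) λ C → IsCycle G C × (γsum G γ C ≡ α) × (∣ C ∣ ≡ k)

IsMinCycle : (G : Graph) {t : ℕ} → (Fin (m G) → GF2^ t) → GF2^ t → Maybe ℕ → Set
IsMinCycle G γ α x = MinIs (CycleOf G γ α) x

module Submission where

-- A closed walk yields a cycle, the set of edges it traverses an odd number of times, with the same
-- parity and at most its length; the symmetric difference of such cycles over a set S with
-- Σ_{δ∈S} δ = α is a cycle C with γ(C) = α and |C| ≤ Σ_{δ∈S} w(δ). Conversely a cycle C splits
-- into closed walks of total length |C| and total parity γ(C); replace each by a shortest closed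
-- walk of the same parity and let S be the set of parities occurring an odd number of times.
-- So each minimum is bounded by the other. Cycles are recognised through their boundary in
-- GF(2)^V, which vanishes exactly when every degree is even.

open import Defs
open import Algebra.Core using (Op₂)
open import Algebra.Structures using (IsCommutativeMonoid)
open import Data.Bool using (Bool; true; false; not; _xor_; if_then_else_)
open import Data.Bool.Properties
  using (xor-assoc; xor-comm; xor-identityˡ; xor-identityʳ; xor-same; not-distribˡ-xor; not-involutive)
  renaming (_≟_ to _≟ᵇ_)
open import Data.Empty using (⊥-elim)
open import Data.Fin using (Fin; zero; suc; _≟_)
open import Data.Fin.Properties using (any?)
open import Data.Fin.Subset using (Subset; ⁅_⁆; ∣_∣; _∈_) renaming (⊥ to ∅)
open import Data.Fin.Subset.Properties using (nonempty?; Empty-unique; ∣⁅x⁆∣≡1; ∣⊥∣≡0; x∈⁅y⁆⇒x≡y)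
open import Data.List using (List; []; _∷_; map; _++_; foldr; allFin; tabulate)
open import Data.List.Properties using (map-∘; map-cong; map-tabulate)
open import Data.Maybe using (Maybe; just; nothing)
open import Data.Nat using (ℕ; zero; suc; _+_; _≤_; _<_; _%_; z≤n; s≤s)
open import Data.Nat.Induction using (<-wellFounded)
open import Data.Nat.Properties
  using (≤-refl; ≤-trans; ≤-reflexive; ≤-antisym; ≮⇒≥; m<1+n⇒m<n∨m≡n; +-mono-≤; +-0-isCommutativeMonoid;
         m≤m+n; suc-injective; +-suc; +-monoʳ-≤; n≤1+n)
open import Data.Product using (Σ; ∃-syntax; _×_; _,_; proj₁; proj₂)
import Data.Product.Properties as Product
open import Data.Sum using (_⊎_; inj₁; inj₂; [_,_]′)
open import Data.Vec using ([]; _∷_; lookup; here; there)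
open import Data.Vec.Properties
  using (zipWith-assoc; zipWith-comm; zipWith-identityˡ; zipWith-identityʳ; lookup-zipWith; lookup-replicate;
         tabulate∘lookup; tabulate-cong; lookup⇒[]=)
  renaming (≡-dec to ≡-decᵛ)
open import Function using (_∘_; _⇔_; mk⇔; Equivalence)
open import Induction.WellFounded using (Acc; acc)
open import Relation.Nullary using (¬_; Dec; yes; no; does)
open import Relation.Nullary.Decidable using (map′; _×-dec_; _⊎-dec_; dec-true; dec-false)
open import Relation.Binary.PropositionalEquality
  using (_≡_; _≢_; refl; sym; trans; cong; cong₂; subst; module ≡-Reasoning)
open import Relation.Binary.PropositionalEquality.Algebra using (isMagma)

⊕-assoc : ∀ {t} (x y z : GF2^ t) → (x ⊕ y) ⊕ z ≡ x ⊕ (y ⊕ z)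
⊕-assoc = zipWith-assoc xor-assoc

⊕-comm : ∀ {t} (x y : GF2^ t) → x ⊕ y ≡ y ⊕ x
⊕-comm = zipWith-comm xor-comm

⊕-identityˡ : ∀ {t} (x : GF2^ t) → 0v ⊕ x ≡ x
⊕-identityˡ = zipWith-identityˡ xor-identityˡ

⊕-identityʳ : ∀ {t} (x : GF2^ t) → x ⊕ 0v ≡ x
⊕-identityʳ = zipWith-identityʳ xor-identityʳ

⊕-self : ∀ {t} (x : GF2^ t) → x ⊕ x ≡ 0v
⊕-self []      = refl
⊕-self (a ∷ x) = cong₂ _∷_ (xor-same a) (⊕-self x)

⊕-cancelˡ : ∀ {t} (x y : GF2^ t) → x ⊕ (x ⊕ y) ≡ y
⊕-cancelˡ x y = begin
  x ⊕ (x ⊕ y)  ≡⟨ ⊕-assoc x x y ⟨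
  (x ⊕ x) ⊕ y  ≡⟨ cong (_⊕ y) (⊕-self x) ⟩
  0v ⊕ y       ≡⟨ ⊕-identityˡ y ⟩
  y            ∎
  where open ≡-Reasoning

⊕-isCommutativeMonoid : ∀ {t} → IsCommutativeMonoid _≡_ (_⊕_ {t}) 0v
⊕-isCommutativeMonoid = record
  { isMonoid = record
    { isSemigroup = record { isMagma = isMagma _⊕_ ; assoc = ⊕-assoc }
    ; identity    = ⊕-identityˡ , ⊕-identityʳ
    }
  ; comm = ⊕-comm
  }

lookup-⊕ : ∀ {t} (x y : GF2^ t) i → lookup (x ⊕ y) i ≡ lookup x i xor lookup y i
lookup-⊕ x y i = lookup-zipWith _xor_ i x y

lookup-0v : ∀ {t} (i : Fin t) → lookup 0v i ≡ false
lookup-0v i = lookup-replicate i false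

lookup-extensionality : ∀ {t} {x y : GF2^ t} → (∀ i → lookup x i ≡ lookup y i) → x ≡ y
lookup-extensionality {x = x} {y} eq =
  trans (sym (tabulate∘lookup x)) (trans (tabulate-cong eq) (tabulate∘lookup y))

if-xor : ∀ {t} (b c : Bool) (x : GF2^ t) →
         (if b xor c then x else 0v) ≡ (if b then x else 0v) ⊕ (if c then x else 0v)
if-xor true  true  x = sym (⊕-self x)
if-xor true  false x = sym (⊕-identityʳ x)
if-xor false c     x = sym (⊕-identityˡ _)

xor≡true : ∀ a b → a xor b ≡ true → a ≡ true ⊎ b ≡ true
xor≡true true  _ _ = inj₁ refl
xor≡true false _ p = inj₂ p

if-xor-≤ : ∀ b c (x y : ℕ) → (if b xor c then (if b then x else y) else 0) ≤ (if b then x else 0) + (if c then y else 0)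
if-xor-≤ true  true  x y = z≤n
if-xor-≤ true  false x y = m≤m+n x 0
if-xor-≤ false true  x y = ≤-refl
if-xor-≤ false false x y = z≤n

⊕-telescope : ∀ {t} (x y z : GF2^ t) → (x ⊕ y) ⊕ (y ⊕ z) ≡ x ⊕ z
⊕-telescope x y z = trans (⊕-assoc x y (y ⊕ z)) (cong (x ⊕_) (⊕-cancelˡ y z))

_≟ᵛ_ : ∀ {t} (x y : GF2^ t) → Dec (x ≡ y)
_≟ᵛ_ = ≡-decᵛ _≟ᵇ_

module ListSum {A : Set} {_∙_ : Op₂ A} {ε : A} (isCM : IsCommutativeMonoid _≡_ _∙_ ε) where
  open IsCommutativeMonoid isCM using (assoc; comm; identityˡ; identityʳ)
  open ≡-Reasoning

  sumOf : ∀ {B : Set} → (B → A) → List B → A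
  sumOf h L = foldr _∙_ ε (map h L)

  sumOf-vanishing : ∀ {B : Set} {h : B → A} (L : List B) → (∀ x → h x ≡ ε) → sumOf h L ≡ ε
  sumOf-vanishing []      h≡ε = refl
  sumOf-vanishing (x ∷ L) h≡ε = trans (cong₂ _∙_ (h≡ε x) (sumOf-vanishing L h≡ε)) (identityˡ ε)

  sumOf-cong : ∀ {B : Set} {f g : B → A} (L : List B) → (∀ x → f x ≡ g x) → sumOf f L ≡ sumOf g L
  sumOf-cong L f≡g = cong (foldr _∙_ ε) (map-cong f≡g L)

  sumOf-++ : ∀ {B : Set} (h : B → A) L L′ → sumOf h (L ++ L′) ≡ sumOf h L ∙ sumOf h L′
  sumOf-++ h []      L′ = sym (identityˡ _)
  sumOf-++ h (x ∷ L) L′ = trans (cong (h x ∙_) (sumOf-++ h L L′)) (sym (assoc _ _ _))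

  sumOf-map : ∀ {B C : Set} (h : C → A) (g : B → C) L → sumOf h (map g L) ≡ sumOf (h ∘ g) L
  sumOf-map h g L = cong (foldr _∙_ ε) (sym (map-∘ L))

  interchange : ∀ a b c d → (a ∙ b) ∙ (c ∙ d) ≡ (a ∙ c) ∙ (b ∙ d)
  interchange a b c d = begin
    (a ∙ b) ∙ (c ∙ d)  ≡⟨ assoc a b (c ∙ d) ⟩
    a ∙ (b ∙ (c ∙ d))  ≡⟨ cong (a ∙_) (assoc b c d) ⟨
    a ∙ ((b ∙ c) ∙ d)  ≡⟨ cong (λ z → a ∙ (z ∙ d)) (comm b c) ⟩
    a ∙ ((c ∙ b) ∙ d)  ≡⟨ cong (a ∙_) (assoc c b d) ⟩
    a ∙ (c ∙ (b ∙ d))  ≡⟨ assoc a c (b ∙ d) ⟨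
    (a ∙ c) ∙ (b ∙ d)  ∎

  sumOf-∙ : ∀ {B : Set} (f g : B → A) L → sumOf (λ x → f x ∙ g x) L ≡ sumOf f L ∙ sumOf g L
  sumOf-∙ f g []      = sym (identityˡ ε)
  sumOf-∙ f g (x ∷ L) =
    trans (cong ((f x ∙ g x) ∙_) (sumOf-∙ f g L)) (interchange (f x) (g x) _ _)

  -- allVecs lists every vector exactly once.
  sumOf-allVecs-at : ∀ {t} {h : GF2^ t → A} (d : GF2^ t) → (∀ x → x ≢ d → h x ≡ ε) →
                     sumOf h (allVecs t) ≡ h d
  sumOf-allVecs-at {h = h} [] _ = identityʳ (h [])
  sumOf-allVecs-at {suc t} {h} (b ∷ d) h≡ε = begin
    sumOf h (map (false ∷_) (allVecs t) ++ map (true ∷_) (allVecs t))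
      ≡⟨ sumOf-++ h (map (false ∷_) (allVecs t)) _ ⟩
    sumOf h (map (false ∷_) (allVecs t)) ∙ sumOf h (map (true ∷_) (allVecs t))
      ≡⟨ cong₂ _∙_ (sumOf-map h (false ∷_) (allVecs t)) (sumOf-map h (true ∷_) (allVecs t)) ⟩
    sumOf (h ∘ (false ∷_)) (allVecs t) ∙ sumOf (h ∘ (true ∷_)) (allVecs t)
      ≡⟨ halves b h≡ε ⟩
    h (b ∷ d) ∎
    where
    tail-≢ : ∀ {b c x} → x ≢ d → c ∷ x ≢ b ∷ d
    tail-≢ x≢d refl = x≢d refl

    halves : ∀ b → (∀ x → x ≢ b ∷ d → h x ≡ ε) →
             sumOf (h ∘ (false ∷_)) (allVecs t) ∙ sumOf (h ∘ (true ∷_)) (allVecs t) ≡ h (b ∷ d)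
    halves false vanishes = trans
      (cong₂ _∙_ (sumOf-allVecs-at d λ x → vanishes _ ∘ tail-≢)
                 (sumOf-vanishing (allVecs t) λ x → vanishes _ λ ()))
      (identityʳ _)
    halves true vanishes = trans
      (cong₂ _∙_ (sumOf-vanishing (allVecs t) λ x → vanishes _ λ ())
                 (sumOf-allVecs-at d λ x → vanishes _ ∘ tail-≢))
      (identityˡ _)

  sumOf-indicator : ∀ {t} (d : GF2^ t) (h : GF2^ t → A) →
                    sumOf (λ x → if does (x ≟ᵛ d) then h x else ε) (allVecs t) ≡ h d
  sumOf-indicator d h = begin
    sumOf (λ x → if does (x ≟ᵛ d) then h x else ε) (allVecs _)
      ≡⟨ sumOf-allVecs-at d (λ x x≢d → cong (if_then h x else ε) (dec-false (x ≟ᵛ d) x≢d)) ⟩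
    (if does (d ≟ᵛ d) then h d else ε) ≡⟨ cong (if_then h d else ε) (dec-true (d ≟ᵛ d) refl) ⟩
    h d ∎

module ⊕-Sum {t : ℕ} = ListSum (⊕-isCommutativeMonoid {t})
module +-Sum = ListSum +-0-isCommutativeMonoid

sumOf-mono-≤ : ∀ {B : Set} {f g : B → ℕ} (L : List B) → (∀ x → f x ≤ g x) → +-Sum.sumOf f L ≤ +-Sum.sumOf g L
sumOf-mono-≤ []      f≤g = z≤n
sumOf-mono-≤ (x ∷ L) f≤g = +-mono-≤ (f≤g x) (sumOf-mono-≤ L f≤g)

AtMost : (ℕ → Set) → ℕ → Set
AtMost P k = ∃[ j ] j ≤ k × P j

_≼_ : (ℕ → Set) → (ℕ → Set) → Set
P ≼ Q = ∀ {k} → P k → AtMost Q k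

MinIs-transfer : ∀ {P Q : ℕ → Set} → P ≼ Q → Q ≼ P → ∀ x → MinIs P x → MinIs Q x
MinIs-transfer P≼Q Q≼P nothing  noP k Qk with Q≼P Qk
... | j , _ , Pj = noP j Pj
MinIs-transfer {Q = Q} P≼Q Q≼P (just k) (Pk , k-least) with P≼Q Pk
... | j , j≤k , Qj with Q≼P Qj
...   | i , i≤j , Pi = subst Q (≤-antisym j≤k (≤-trans (k-least i Pi) i≤j)) Qj , Q-bound
  where
  Q-bound : ∀ l → Q l → k ≤ l
  Q-bound l Ql with Q≼P Ql
  ... | i′ , i′≤l , Pi′ = ≤-trans (k-least i′ Pi′) i′≤l

module _ {P : ℕ → Set} (P? : ∀ k → Dec (P k)) where

  private
    leastBelow : ∀ l → (∃[ k ] MinIs P (just k)) ⊎ (∀ j → j < l → ¬ P j)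
    leastBelow zero = inj₂ λ _ ()
    leastBelow (suc l) with leastBelow l
    ... | inj₁ found = inj₁ found
    ... | inj₂ none with P? l
    ...   | yes Pl = inj₁ (l , Pl , λ j Pj → ≮⇒≥ λ j<l → none j j<l Pj)
    ...   | no ¬Pl = inj₂ λ j j<1+l → [ none j , (λ { refl → ¬Pl }) ]′ (m<1+n⇒m<n∨m≡n j<1+l)

  least-witness : P ≼ (λ j → MinIs P (just j))
  least-witness {k} Pk with leastBelow (suc k)
  ... | inj₁ (j , j-min) = j , proj₂ j-min k Pk , j-min
  ... | inj₂ none = ⊥-elim (none k ≤-refl Pk)

parity : ℕ → Bool
parity zero    = false
parity (suc k) = not (parity k)

parity-+ : ∀ a b → parity (a + b) ≡ parity a xor parity b
parity-+ zero    b = refl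
parity-+ (suc a) b = trans (cong not (parity-+ a b)) (not-distribˡ-xor (parity a) (parity b))

even⇔parity≡false : ∀ k → k % 2 ≡ 0 ⇔ parity k ≡ false
even⇔parity≡false k = mk⇔ (to k) (from k)
  where
  to : ∀ k → k % 2 ≡ 0 → parity k ≡ false
  to zero          _    = refl
  to (suc (suc k)) even = trans (not-involutive (parity k)) (to k even)

  from : ∀ k → parity k ≡ false → k % 2 ≡ 0
  from zero          _ = refl
  from (suc (suc k)) p = from k (trans (sym (not-involutive (parity k))) p)

subsetSum : ∀ {k t} → (Fin k → GF2^ t) → Subset k → GF2^ t
subsetSum g []      = 0v
subsetSum g (b ∷ C) = (if b then g zero else 0v) ⊕ subsetSum (g ∘ suc) C

sumOverAllFin≡subsetSum : ∀ {k t} (g : Fin k → GF2^ t) (C : Subset k) →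
  ⊕-Sum.sumOf (λ e → if lookup C e then g e else 0v) (allFin k) ≡ subsetSum g C
sumOverAllFin≡subsetSum g []      = refl
sumOverAllFin≡subsetSum g (b ∷ C) = cong ((if b then g zero else 0v) ⊕_) (begin
  foldr _⊕_ 0v (map summand (tabulate suc))  ≡⟨ cong (foldr _⊕_ 0v) (map-tabulate suc summand) ⟩
  foldr _⊕_ 0v (tabulate (summand ∘ suc))    ≡⟨ cong (foldr _⊕_ 0v) (map-tabulate (λ e → e) (summand ∘ suc)) ⟨
  ⊕-Sum.sumOf (summand ∘ suc) (allFin _)     ≡⟨ sumOverAllFin≡subsetSum (g ∘ suc) C ⟩
  subsetSum (g ∘ suc) C                      ∎)
  where
  open ≡-Reasoning
  summand : Fin _ → GF2^ _
  summand e = if lookup (b ∷ C) e then g e else 0v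

subsetSum-⊕ : ∀ {k t} (g : Fin k → GF2^ t) (C D : Subset k) →
              subsetSum g (C ⊕ D) ≡ subsetSum g C ⊕ subsetSum g D
subsetSum-⊕ g []      []      = sym (⊕-self 0v)
subsetSum-⊕ g (b ∷ C) (c ∷ D) =
  trans (cong₂ _⊕_ (if-xor b c (g zero)) (subsetSum-⊕ (g ∘ suc) C D)) (⊕-Sum.interchange _ _ _ _)

subsetSum-∅ : ∀ {k t} (g : Fin k → GF2^ t) → subsetSum g ∅ ≡ 0v
subsetSum-∅ {zero}  g = refl
subsetSum-∅ {suc k} g = trans (⊕-identityˡ _) (subsetSum-∅ (g ∘ suc))

subsetSum-⁅⁆ : ∀ {k t} (g : Fin k → GF2^ t) (e : Fin k) → subsetSum g ⁅ e ⁆ ≡ g e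
subsetSum-⁅⁆ g zero    = trans (cong (g zero ⊕_) (subsetSum-∅ (g ∘ suc))) (⊕-identityʳ _)
subsetSum-⁅⁆ g (suc e) = trans (⊕-identityˡ _) (subsetSum-⁅⁆ (g ∘ suc) e)

subsetSum-witness : ∀ {k t} (g : Fin k → GF2^ t) (C : Subset k) i → lookup (subsetSum g C) i ≡ true →
                    ∃[ e ] e ∈ C × lookup (g e) i ≡ true
subsetSum-witness g [] i sum-i with trans (sym (lookup-0v i)) sum-i
... | ()
subsetSum-witness g (true ∷ C) i sum-i
  with xor≡true (lookup (g zero) i) _ (trans (sym (lookup-⊕ (g zero) _ i)) sum-i)
... | inj₁ head-i = zero , here , head-i
... | inj₂ rest-i = shift (subsetSum-witness (g ∘ suc) C i rest-i)
  where
  shift : ∃[ e ] e ∈ C × lookup (g (suc e)) i ≡ true → ∃[ e ] e ∈ true ∷ C × lookup (g e) i ≡ true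
  shift (e , e∈C , ge-i) = suc e , there e∈C , ge-i
subsetSum-witness g (false ∷ C) i sum-i
  with subsetSum-witness (g ∘ suc) C i (trans (cong (λ v → lookup v i) (sym (⊕-identityˡ _))) sum-i)
... | e , e∈C , ge-i = suc e , there e∈C , ge-i

∣p⊕q∣≤∣p∣+∣q∣ : ∀ {k} (p q : Subset k) → ∣ p ⊕ q ∣ ≤ ∣ p ∣ + ∣ q ∣
∣p⊕q∣≤∣p∣+∣q∣ []          []          = z≤n
∣p⊕q∣≤∣p∣+∣q∣ (true  ∷ p) (true  ∷ q) =
  ≤-trans (∣p⊕q∣≤∣p∣+∣q∣ p q) (≤-trans (+-monoʳ-≤ ∣ p ∣ (n≤1+n ∣ q ∣)) (n≤1+n _))
∣p⊕q∣≤∣p∣+∣q∣ (true  ∷ p) (false ∷ q) = s≤s (∣p⊕q∣≤∣p∣+∣q∣ p q)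
∣p⊕q∣≤∣p∣+∣q∣ (false ∷ p) (true  ∷ q) =
  ≤-trans (s≤s (∣p⊕q∣≤∣p∣+∣q∣ p q)) (≤-reflexive (sym (+-suc ∣ p ∣ ∣ q ∣)))
∣p⊕q∣≤∣p∣+∣q∣ (false ∷ p) (false ∷ q) = ∣p⊕q∣≤∣p∣+∣q∣ p q

x∈p⇒∣p⊕⁅x⁆∣<∣p∣ : ∀ {k} {p : Subset k} {x} → x ∈ p → ∣ p ⊕ ⁅ x ⁆ ∣ < ∣ p ∣
x∈p⇒∣p⊕⁅x⁆∣<∣p∣ {p = true ∷ p}  here       = s≤s (≤-reflexive (cong ∣_∣ (⊕-identityʳ p)))
x∈p⇒∣p⊕⁅x⁆∣<∣p∣ {p = true ∷ p}  (there x∈p) = s≤s (x∈p⇒∣p⊕⁅x⁆∣<∣p∣ x∈p)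
x∈p⇒∣p⊕⁅x⁆∣<∣p∣ {p = false ∷ p} (there x∈p) = x∈p⇒∣p⊕⁅x⁆∣<∣p∣ x∈p

-- Boundaries

lookup-⁅⁆ : ∀ {k} (p x : Fin k) → lookup ⁅ p ⁆ x ≡ does (p ≟ x)
lookup-⁅⁆ zero    zero    = refl
lookup-⁅⁆ zero    (suc x) = lookup-0v x
lookup-⁅⁆ (suc p) zero    = refl
lookup-⁅⁆ (suc p) (suc x) = lookup-⁅⁆ p x

lookup-⁅⁆≡true : ∀ {k} {p x : Fin k} → lookup ⁅ p ⁆ x ≡ true → p ≡ x
lookup-⁅⁆≡true {p = p} {x} eq = sym (x∈⁅y⁆⇒x≡y p (lookup⇒[]= x ⁅ p ⁆ eq))

lookup-⁅a⁆⊕⁅v⁆ : ∀ {k} {a v : Fin k} → a ≢ v → lookup (⁅ a ⁆ ⊕ ⁅ v ⁆) v ≡ true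
lookup-⁅a⁆⊕⁅v⁆ {a = a} {v} a≢v = begin
  lookup (⁅ a ⁆ ⊕ ⁅ v ⁆) v             ≡⟨ lookup-⊕ ⁅ a ⁆ ⁅ v ⁆ v ⟩
  lookup ⁅ a ⁆ v xor lookup ⁅ v ⁆ v    ≡⟨ cong₂ _xor_ (lookup-⁅⁆ a v) (lookup-⁅⁆ v v) ⟩
  does (a ≟ v) xor does (v ≟ v)        ≡⟨ cong₂ _xor_ (dec-false (a ≟ v) a≢v) (dec-true (v ≟ v) refl) ⟩
  true                                 ∎
  where open ≡-Reasoning

parity-sum≡lookup-sum : ∀ {A : Set} {t} (L : List A) (f : A → ℕ) (φ : A → GF2^ t) (i : Fin t) →
                        (∀ a → parity (f a) ≡ lookup (φ a) i) →
                        parity (+-Sum.sumOf f L) ≡ lookup (⊕-Sum.sumOf φ L) i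
parity-sum≡lookup-sum []      f φ i termwise = sym (lookup-0v i)
parity-sum≡lookup-sum (a ∷ L) f φ i termwise = begin
  parity (f a + +-Sum.sumOf f L)                     ≡⟨ parity-+ (f a) _ ⟩
  parity (f a) xor parity (+-Sum.sumOf f L)          ≡⟨ cong₂ _xor_ (termwise a) (parity-sum≡lookup-sum L f φ i termwise) ⟩
  lookup (φ a) i xor lookup (⊕-Sum.sumOf φ L) i      ≡⟨ lookup-⊕ (φ a) _ i ⟨
  lookup (φ a ⊕ ⊕-Sum.sumOf φ L) i                   ∎
  where open ≡-Reasoning

-- The left-hand side is the summand of deg G C x as written in Defs.
parity-edge : ∀ {k} b (p q x : Fin k) →
              parity (if b then [ does (p ≟ x) ] + [ does (q ≟ x) ] else 0) ≡
              lookup (if b then ⁅ p ⁆ ⊕ ⁅ q ⁆ else 0v) x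
parity-edge false p q x = sym (lookup-0v x)
parity-edge true  p q x = begin
  parity ([ does (p ≟ x) ] + [ does (q ≟ x) ])   ≡⟨ parity-+ [ does (p ≟ x) ] _ ⟩
  parity [ does (p ≟ x) ] xor parity [ does (q ≟ x) ]
    ≡⟨ cong₂ _xor_ (parity-indicator (does (p ≟ x))) (parity-indicator (does (q ≟ x))) ⟩
  does (p ≟ x) xor does (q ≟ x)                  ≡⟨ cong₂ _xor_ (lookup-⁅⁆ p x) (lookup-⁅⁆ q x) ⟨
  lookup ⁅ p ⁆ x xor lookup ⁅ q ⁆ x              ≡⟨ lookup-⊕ ⁅ p ⁆ ⁅ q ⁆ x ⟨
  lookup (⁅ p ⁆ ⊕ ⁅ q ⁆) x                       ∎
  where
  open ≡-Reasoning
  parity-indicator : ∀ b → parity [ b ] ≡ b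
  parity-indicator true  = refl
  parity-indicator false = refl

module _ (G : Graph) where

  incidence : Fin (m G) → GF2^ (n G)
  incidence e = ⁅ proj₁ (ends G e) ⁆ ⊕ ⁅ proj₂ (ends G e) ⁆

  boundary : Subset (m G) → GF2^ (n G)
  boundary = subsetSum incidence

  lookup-boundary : ∀ C x → lookup (boundary C) x ≡ parity (deg G C x)
  lookup-boundary C x = sym (begin
    parity (deg G C x)
      ≡⟨ parity-sum≡lookup-sum (allFin (m G)) _ _ x
           (λ e → parity-edge (lookup C e) (proj₁ (ends G e)) (proj₂ (ends G e)) x) ⟩
    lookup (⊕-Sum.sumOf (λ e → if lookup C e then incidence e else 0v) (allFin (m G))) x
      ≡⟨ cong (λ v → lookup v x) (sumOverAllFin≡subsetSum incidence C) ⟩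
    lookup (boundary C) x ∎)
    where open ≡-Reasoning

  isCycle⇔boundary≡0v : ∀ C → IsCycle G C ⇔ boundary C ≡ 0v
  isCycle⇔boundary≡0v C = mk⇔
    (λ even → lookup-extensionality λ x →
      trans (lookup-boundary C x)
            (trans (Equivalence.to (even⇔parity≡false (deg G C x)) (even x)) (sym (lookup-0v x))))
    (λ ∂C≡0 x → Equivalence.from (even⇔parity≡false (deg G C x))
      (trans (sym (lookup-boundary C x)) (trans (cong (λ v → lookup v x) ∂C≡0) (lookup-0v x))))

  incidence-Joins : ∀ {e u w} → Joins G e u w → incidence e ≡ ⁅ u ⁆ ⊕ ⁅ w ⁆
  incidence-Joins (inj₁ ends≡uw) = cong (λ ends → ⁅ proj₁ ends ⁆ ⊕ ⁅ proj₂ ends ⁆) ends≡uw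
  incidence-Joins (inj₂ ends≡wu) =
    trans (cong (λ ends → ⁅ proj₁ ends ⁆ ⊕ ⁅ proj₂ ends ⁆) ends≡wu) (⊕-comm _ _)

  edge-at-odd-vertex : ∀ C v → lookup (boundary C) v ≡ true → ∃[ e ] ∃[ w ] e ∈ C × Joins G e v w
  edge-at-odd-vertex C v odd with subsetSum-witness incidence C v odd
  ... | e , e∈C , inc-v
    with xor≡true _ _ (trans (sym (lookup-⊕ ⁅ proj₁ (ends G e) ⁆ ⁅ proj₂ (ends G e) ⁆ v)) inc-v)
  ... | inj₁ first-v  = e , _ , e∈C , inj₁ (cong (_, proj₂ (ends G e)) (lookup-⁅⁆≡true first-v))
  ... | inj₂ second-v = e , _ , e∈C , inj₂ (cong (proj₁ (ends G e) ,_) (lookup-⁅⁆≡true second-v))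

  oddEdges : ∀ {u v} → Walk G u v → Subset (m G)
  oddEdges nil          = ∅
  oddEdges (cons e _ W) = ⁅ e ⁆ ⊕ oddEdges W

  subsetSum-oddEdges : ∀ {t u v} (g : Fin (m G) → GF2^ t) (W : Walk G u v) →
                       subsetSum g (oddEdges W) ≡ walkParity g W
  subsetSum-oddEdges g nil          = subsetSum-∅ g
  subsetSum-oddEdges g (cons e _ W) =
    trans (subsetSum-⊕ g ⁅ e ⁆ (oddEdges W)) (cong₂ _⊕_ (subsetSum-⁅⁆ g e) (subsetSum-oddEdges g W))

  ∣oddEdges∣≤walkLength : ∀ {u v} (W : Walk G u v) → ∣ oddEdges W ∣ ≤ walkLength W
  ∣oddEdges∣≤walkLength nil          = ≤-reflexive (∣⊥∣≡0 (m G))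
  ∣oddEdges∣≤walkLength (cons e _ W) =
    ≤-trans (∣p⊕q∣≤∣p∣+∣q∣ ⁅ e ⁆ (oddEdges W))
            (≤-trans (≤-reflexive (cong (_+ ∣ oddEdges W ∣) (∣⁅x⁆∣≡1 e))) (s≤s (∣oddEdges∣≤walkLength W)))

  walkParity-incidence : ∀ {u v} (W : Walk G u v) → walkParity incidence W ≡ ⁅ u ⁆ ⊕ ⁅ v ⁆
  walkParity-incidence {u} nil = sym (⊕-self ⁅ u ⁆)
  walkParity-incidence {u} {v} (cons {w = w} e u~w W) =
    trans (cong₂ _⊕_ (incidence-Joins u~w) (walkParity-incidence W)) (⊕-telescope ⁅ u ⁆ ⁅ w ⁆ ⁅ v ⁆)

  boundary-oddEdges : ∀ {u v} (W : Walk G u v) → boundary (oddEdges W) ≡ ⁅ u ⁆ ⊕ ⁅ v ⁆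
  boundary-oddEdges W = trans (subsetSum-oddEdges incidence W) (walkParity-incidence W)

module _ {t : ℕ} (R : GF2^ t → ℕ → Set) (R-0 : R 0v 0)
         (R-⊕ : ∀ {β β′ j j′} → R β j → R β′ j′ → AtMost (R (β ⊕ β′)) (j + j′)) where

  AtMost-sumOf : ∀ {A : Set} (L : List A) (φ : A → GF2^ t) (ψ : A → ℕ) → (∀ a → AtMost (R (φ a)) (ψ a)) →
                 AtMost (R (⊕-Sum.sumOf φ L)) (+-Sum.sumOf ψ L)
  AtMost-sumOf []      φ ψ bound = 0 , z≤n , R-0
  AtMost-sumOf (a ∷ L) φ ψ bound with bound a | AtMost-sumOf L φ ψ bound
  ... | j , j≤ψa , Rj | j′ , j′≤ψL , Rj′ with R-⊕ Rj Rj′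
  ...   | i , i≤j+j′ , Ri = i , ≤-trans i≤j+j′ (+-mono-≤ j≤ψa j′≤ψL) , Ri

module _ (G : Graph) {t : ℕ} (γ : Fin (m G) → GF2^ t) where

  γsum≡subsetSum : ∀ C → γsum G γ C ≡ subsetSum γ C
  γsum≡subsetSum = sumOverAllFin≡subsetSum γ

  WalkOf : ℕ → Fin (n G) → Fin (n G) → GF2^ t → Set
  WalkOf k u v β = Σ (Walk G u v) λ W → walkLength W ≡ k × walkParity γ W ≡ β

  joins? : ∀ e u w → Dec (Joins G e u w)
  joins? e u w = ends G e ≟ᵉ (u , w) ⊎-dec ends G e ≟ᵉ (w , u)
    where _≟ᵉ_ = Product.≡-dec _≟_ _≟_

  walkOf? : ∀ k u v β → Dec (WalkOf k u v β)
  walkOf? zero u v β = map′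
    (λ { (refl , 0≡β) → nil , refl , 0≡β })
    (λ { (nil , _ , 0≡β) → refl , 0≡β ; (cons _ _ _ , () , _) })
    (u ≟ v ×-dec 0v ≟ᵛ β)
  walkOf? (suc k) u v β = map′ extend split
    (any? λ e → any? λ w → joins? e u w ×-dec walkOf? k w v (γ e ⊕ β))
    where
    extend : (∃[ e ] ∃[ w ] Joins G e u w × WalkOf k w v (γ e ⊕ β)) → WalkOf (suc k) u v β
    extend (e , w , u~w , W , len , par) =
      cons e u~w W , cong suc len , trans (cong (γ e ⊕_) par) (⊕-cancelˡ (γ e) β)

    split : WalkOf (suc k) u v β → ∃[ e ] ∃[ w ] Joins G e u w × WalkOf k w v (γ e ⊕ β)
    split (cons {w = w} e u~w W , len , par) =
      e , w , u~w , W , suc-injective len , trans (sym (⊕-cancelˡ (γ e) _)) (cong (γ e ⊕_) par)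

  closedWalkOf? : ∀ β k → Dec (ClosedWalkOf G γ β k)
  closedWalkOf? β k = any? λ u → walkOf? k u u β

  cycle-∅ : CycleOf G γ 0v 0
  cycle-∅ = ∅ , Equivalence.from (isCycle⇔boundary≡0v G ∅) (subsetSum-∅ (incidence G)) ,
            trans (γsum≡subsetSum ∅) (subsetSum-∅ γ) , ∣⊥∣≡0 (m G)

  cycle-⊕ : ∀ {β β′ j j′} → CycleOf G γ β j → CycleOf G γ β′ j′ → AtMost (CycleOf G γ (β ⊕ β′)) (j + j′)
  cycle-⊕ (C , C-cycle , γC≡β , refl) (D , D-cycle , γD≡β′ , refl) =
    ∣ C ⊕ D ∣ , ∣p⊕q∣≤∣p∣+∣q∣ C D , C ⊕ D ,
    Equivalence.from (isCycle⇔boundary≡0v G (C ⊕ D))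
      (trans (subsetSum-⊕ (incidence G) C D) (trans (cong₂ _⊕_ (∂≡0 C C-cycle) (∂≡0 D D-cycle)) (⊕-self 0v))) ,
    trans (γsum≡subsetSum (C ⊕ D))
      (trans (subsetSum-⊕ γ C D)
             (cong₂ _⊕_ (trans (sym (γsum≡subsetSum C)) γC≡β) (trans (sym (γsum≡subsetSum D)) γD≡β′))) ,
    refl
    where
    ∂≡0 : ∀ C → IsCycle G C → boundary G C ≡ 0v
    ∂≡0 C = Equivalence.to (isCycle⇔boundary≡0v G C)

  closedWalk⇒cycle : ∀ {β} → ClosedWalkOf G γ β ≼ CycleOf G γ β
  closedWalk⇒cycle (u , W , refl , refl) =
    ∣ oddEdges G W ∣ , ∣oddEdges∣≤walkLength G W , oddEdges G W ,
    Equivalence.from (isCycle⇔boundary≡0v G (oddEdges G W)) (trans (boundary-oddEdges G W) (⊕-self ⁅ u ⁆)) ,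
    trans (γsum≡subsetSum (oddEdges G W)) (subsetSum-oddEdges G γ W) , refl

  weight-∅ : SubsetWeight G γ 0v 0
  weight-∅ = (λ _ → false) , ⊕-Sum.sumOf-vanishing (allVecs t) (λ _ → refl) ,
             (λ _ → 0) , (λ _ ()) , +-Sum.sumOf-vanishing (allVecs t) (λ _ → refl)

  weight-singleton : ∀ {β w} → IsW G γ β (just w) → SubsetWeight G γ β w
  weight-singleton {β} {w} isW =
    (λ δ → does (δ ≟ᵛ β)) , ⊕-Sum.sumOf-indicator β (λ δ → δ) ,
    (λ _ → w) , isW-on , +-Sum.sumOf-indicator β (λ _ → w)
    where
    isW-on : ∀ δ → does (δ ≟ᵛ β) ≡ true → IsW G γ δ (just w)
    isW-on δ _ with δ ≟ᵛ β
    isW-on δ _  | yes refl = isW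
    isW-on δ () | no _

  weight-⊕ : ∀ {β β′ j j′} → SubsetWeight G γ β j → SubsetWeight G γ β′ j′ →
             AtMost (SubsetWeight G γ (β ⊕ β′)) (j + j′)
  weight-⊕ {β} {β′} (S , ΣS≡β , f , f-min , refl) (S′ , ΣS′≡β′ , f′ , f′-min , refl) =
    _ , weight≤ , S⊕S′ , sum≡ , g , g-min , refl
    where
    S⊕S′ : GF2^ t → Bool
    S⊕S′ δ = S δ xor S′ δ

    g : GF2^ t → ℕ
    g δ = if S δ then f δ else f′ δ

    sum≡ : sumSet S⊕S′ ≡ β ⊕ β′
    sum≡ = trans (⊕-Sum.sumOf-cong (allVecs t) (λ δ → if-xor (S δ) (S′ δ) δ))
                 (trans (⊕-Sum.sumOf-∙ _ _ (allVecs t)) (cong₂ _⊕_ ΣS≡β ΣS′≡β′))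

    g-min : ∀ δ → S⊕S′ δ ≡ true → IsW G γ δ (just (g δ))
    g-min δ with S δ in Sδ
    ... | true  = λ _ → f-min δ Sδ
    ... | false = f′-min δ

    weight≤ : +-Sum.sumOf (λ δ → if S⊕S′ δ then g δ else 0) (allVecs t) ≤
              +-Sum.sumOf (λ δ → if S δ then f δ else 0) (allVecs t) +
              +-Sum.sumOf (λ δ → if S′ δ then f′ δ else 0) (allVecs t)
    weight≤ = ≤-trans (sumOf-mono-≤ (allVecs t) (λ δ → if-xor-≤ (S δ) (S′ δ) (f δ) (f′ δ)))
                      (≤-reflexive (+-Sum.sumOf-∙ _ _ (allVecs t)))

  closedWalk⇒weight : ∀ {β} → ClosedWalkOf G γ β ≼ SubsetWeight G γ β
  closedWalk⇒weight {β} walk with least-witness (closedWalkOf? β) walk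
  ... | w , w≤k , isW = w , w≤k , weight-singleton isW

  -- Decomposing a cycle into closed walks

  ClosedWalk : Set
  ClosedWalk = Σ (Fin (n G)) λ u → Walk G u u

  cwLength : ClosedWalk → ℕ
  cwLength (_ , W) = walkLength W

  cwParity : ClosedWalk → GF2^ t
  cwParity (_ , W) = walkParity γ W

  ClosedWalks : Subset (m G) → Set
  ClosedWalks C = Σ (List ClosedWalk) λ Ws →
    +-Sum.sumOf cwLength Ws ≤ ∣ C ∣ × ⊕-Sum.sumOf cwParity Ws ≡ subsetSum γ C

  Trail : Subset (m G) → Fin (n G) → Fin (n G) → Set
  Trail C v a = Σ (Walk G v a) λ W → Σ (List ClosedWalk) λ Ws →
    walkLength W + +-Sum.sumOf cwLength Ws ≤ ∣ C ∣ × walkParity γ W ⊕ ⊕-Sum.sumOf cwParity Ws ≡ subsetSum γ C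

  boundary-toggle : ∀ C {e a v w} → Joins G e v w → boundary G C ≡ ⁅ a ⁆ ⊕ ⁅ v ⁆ →
                    boundary G (C ⊕ ⁅ e ⁆) ≡ ⁅ a ⁆ ⊕ ⁅ w ⁆
  boundary-toggle C {e} {a} {v} {w} v~w ∂C = begin
    boundary G (C ⊕ ⁅ e ⁆)                  ≡⟨ subsetSum-⊕ (incidence G) C ⁅ e ⁆ ⟩
    boundary G C ⊕ subsetSum (incidence G) ⁅ e ⁆
      ≡⟨ cong₂ _⊕_ ∂C (trans (subsetSum-⁅⁆ (incidence G) e) (incidence-Joins G v~w)) ⟩
    (⁅ a ⁆ ⊕ ⁅ v ⁆) ⊕ (⁅ v ⁆ ⊕ ⁅ w ⁆)        ≡⟨ ⊕-telescope ⁅ a ⁆ ⁅ v ⁆ ⁅ w ⁆ ⟩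
    ⁅ a ⁆ ⊕ ⁅ w ⁆                           ∎
    where open ≡-Reasoning

  prepend-edge : ∀ {C e v w a} → e ∈ C → Joins G e v w → Trail (C ⊕ ⁅ e ⁆) w a → Trail C v a
  prepend-edge {C} {e} e∈C v~w (W , Ws , len , par) =
    cons e v~w W , Ws , ≤-trans (s≤s len) (x∈p⇒∣p⊕⁅x⁆∣<∣p∣ e∈C) , (begin
      (γ e ⊕ walkParity γ W) ⊕ ⊕-Sum.sumOf cwParity Ws  ≡⟨ ⊕-assoc (γ e) _ _ ⟩
      γ e ⊕ (walkParity γ W ⊕ ⊕-Sum.sumOf cwParity Ws)  ≡⟨ cong (γ e ⊕_) par ⟩
      γ e ⊕ subsetSum γ (C ⊕ ⁅ e ⁆)                     ≡⟨ cong (γ e ⊕_) (subsetSum-⊕ γ C ⁅ e ⁆) ⟩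
      γ e ⊕ (subsetSum γ C ⊕ subsetSum γ ⁅ e ⁆)
        ≡⟨ cong (γ e ⊕_) (trans (cong (subsetSum γ C ⊕_) (subsetSum-⁅⁆ γ e)) (⊕-comm _ (γ e))) ⟩
      γ e ⊕ (γ e ⊕ subsetSum γ C)                       ≡⟨ ⊕-cancelˡ (γ e) _ ⟩
      subsetSum γ C                                     ∎)
    where open ≡-Reasoning

  -- trail walks from v along edges of C, removing each edge it uses. While v ≠ a the vertex v has
  -- odd degree, so there is always an edge to continue; at a what remains of C is again a cycle.
  mutual
    closedWalks : ∀ C → Acc _<_ ∣ C ∣ → boundary G C ≡ 0v → ClosedWalks C
    closedWalks C _ ∂C with nonempty? C
    ... | no C-empty =
      [] , z≤n , sym (trans (cong (subsetSum γ) (Empty-unique C-empty)) (subsetSum-∅ γ))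
    closedWalks C (acc smaller) ∂C | yes (e , e∈C)
      with prepend-edge e∈C (inj₁ refl)
             (trail (C ⊕ ⁅ e ⁆) p q (smaller (x∈p⇒∣p⊕⁅x⁆∣<∣p∣ e∈C))
                    (boundary-toggle C (inj₁ refl) (trans ∂C (sym (⊕-self ⁅ p ⁆)))))
      where
      p q : Fin (n G)
      p = proj₁ (ends G e)
      q = proj₂ (ends G e)
    ... | W , Ws , len , par = (_ , W) ∷ Ws , len , par

    trail : ∀ C a v → Acc _<_ ∣ C ∣ → boundary G C ≡ ⁅ a ⁆ ⊕ ⁅ v ⁆ → Trail C v a
    trail C a v acc-C ∂C with v ≟ a
    ... | yes refl with closedWalks C acc-C (trans ∂C (⊕-self ⁅ v ⁆))
    ...   | Ws , len , par = nil , Ws , len , trans (⊕-identityˡ _) par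
    trail C a v (acc smaller) ∂C | no v≢a
      with edge-at-odd-vertex G C v (trans (cong (λ x → lookup x v) ∂C) (lookup-⁅a⁆⊕⁅v⁆ (v≢a ∘ sym)))
    ... | e , w , e∈C , v~w =
      prepend-edge e∈C v~w (trail (C ⊕ ⁅ e ⁆) a w (smaller (x∈p⇒∣p⊕⁅x⁆∣<∣p∣ e∈C)) (boundary-toggle C v~w ∂C))

  weights≼cycles : ∀ {α} → SubsetWeight G γ α ≼ CycleOf G γ α
  weights≼cycles (S , ΣS≡α , f , f-min , refl) =
    subst (λ β → AtMost (CycleOf G γ β) _) ΣS≡α
      (AtMost-sumOf (CycleOf G γ) cycle-∅ cycle-⊕ (allVecs t) _ _ summand)
    where
    summand : ∀ δ → AtMost (CycleOf G γ (if S δ then δ else 0v)) (if S δ then f δ else 0)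
    summand δ with S δ in Sδ
    ... | true  = closedWalk⇒cycle (proj₁ (f-min δ Sδ))
    ... | false = 0 , z≤n , cycle-∅

  cycles≼weights : ∀ {α} → CycleOf G γ α ≼ SubsetWeight G γ α
  cycles≼weights (C , C-cycle , γC≡α , refl)
    with closedWalks C (<-wellFounded ∣ C ∣) (Equivalence.to (isCycle⇔boundary≡0v G C) C-cycle)
  ... | Ws , len , par
    with AtMost-sumOf (SubsetWeight G γ) weight-∅ weight-⊕ Ws cwParity cwLength
           (λ { (u , W) → closedWalk⇒weight (u , W , refl , refl) })
  ... | j , j≤ , weight =
    j , ≤-trans j≤ len , subst (λ β → SubsetWeight G γ β j) (trans par (trans (sym (γsum≡subsetSum C)) γC≡α)) weight

lemma6p2 : (G : Graph) (t : ℕ) (γ : Fin (m G) → GF2^ t) (α : GF2^ t) (x : Maybe ℕ) →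
           IsMinCycle G γ α x ⇔ IsWTilde G γ α x
lemma6p2 G t γ α x =
  mk⇔ (MinIs-transfer (cycles≼weights G γ) (weights≼cycles G γ) x)
      (MinIs-transfer (weights≼cycles G γ) (cycles≼weights G γ) x)
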